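{- Every $\Sigma_3$-formula computing $\mathrm{PAR}_n(x_1,\dots,x_n)=x_1\oplus\dots\oplus x_n$ has size $\Omega\left(2^{\sqrt n}/n\right)$, and every $\Sigma_3$-circuit computing $\mathrm{PAR}_n$ has size $\Omega\left(2^{\sqrt{n/2}}/n\right)$.
   Context: A $\Sigma_3$-circuit is a depth-3 circuit whose inputs are variables and their negations, whose output gate is an OR, whose gates on the second layer are ANDs, and whose gates on the third (bottom) layer are ORs of literals; i.e. it is an OR of CNFs which may share clauses. A $\Sigma_3$-formula is a $\Sigma_3$-circuit in which every gate has out-degree one (the CNFs do not share clauses). The size of such a circuit is its number of gates excluding the output gate. -}

module Defs where

open import Data.Nat using (ℕ; zero; suc; _+_)
open import Data.Bool using (Bool; true; false; not; _xor_; if_then_else_)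
open import Data.Fin using (Fin) renaming (zero to fzero; suc to fsuc)
open import Data.Product using (_×_; _,_)
open import Data.List using (List; length; map)
open import Data.Nat.ListAction using (sum)
open import Data.Bool.ListAction using (any; all)
open import Relation.Binary.PropositionalEquality using (_≡_)
open import Function using (_∘_)

Literal : ℕ → Set
Literal n = Fin n × Bool

Assignment : ℕ → Set
Assignment n = Fin n → Bool

evalLit : ∀ {n} → Assignment n → Literal n → Bool
evalLit x (i , true)  = x i
evalLit x (i , false) = not (x i)

Clause : ℕ → Set
Clause n = List (Literal n)

evalClause : ∀ {n} → Assignment n → Clause n → Bool
evalClause x c = any (evalLit x) c

parity : (n : ℕ) → Assignment n → Bool
parity zero    x = false
parity (suc n) x = x fzero xor parity n (x ∘ fsuc)

-- Σ3-circuits: an OR of AND gates, each AND gate reading some of the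
-- m bottom OR gates (which may be shared between AND gates).

record Σ3Circuit (n : ℕ) : Set where
  field
    m       : ℕ
    clauses : Fin m → Clause n
    ands    : List (List (Fin m))

open Σ3Circuit public

-- size = number of gates excluding the output gate
circuitSize : ∀ {n} → Σ3Circuit n → ℕ
circuitSize C = m C + length (ands C)

evalCircuit : ∀ {n} → Σ3Circuit n → Assignment n → Bool
evalCircuit C x = any (all (evalClause x ∘ clauses C)) (ands C)

-- Σ3-formulas: every gate has out-degree one, i.e. an OR of CNFs not
-- sharing clauses; a formula is a list of CNFs, each a list of clauses.

Σ3Formula : ℕ → Set
Σ3Formula n = List (List (Clause n))

formulaSize : ∀ {n} → Σ3Formula n → ℕ
formulaSize F = length F + sum (map length F)

evalFormula : ∀ {n} → Σ3Formula n → Assignment n → Bool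
evalFormula F x = any (all (evalClause x)) F

ComputesF : ∀ {n} → Σ3Formula n → (Assignment n → Bool) → Set
ComputesF {n} F f = (x : Assignment n) → evalFormula F x ≡ f x

ComputesC : ∀ {n} → Σ3Circuit n → (Assignment n → Bool) → Set
ComputesC {n} C f = (x : Assignment n) → evalCircuit C x ≡ f x

module Submission where

-- There are 2 ^ (n - 1) points of odd parity.  Such a point x is accepted by a CNF D of the
-- family, and flipping any x i gives even parity, so D has a clause that is critical for i
-- at x: true at x and false after the flip.  If for some i every such clause has at least k
-- variables besides i, then x lies in one of at most n subcubes of codimension k attached to
-- a single clause, which covers at most n 2 ^ (n - k) points.  Otherwise every variable has a
-- critical clause of width below k, so within D the value of x i is determined by the other
-- variables of that clause; by the satisfiability coding lemma of Paturi, Pudlák and Zane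
-- (revealing the variables in a random order, each is forced with probability at least 1/k)
-- at most 2 ^ (n - k) points are of this kind when k² ≤ n.  Hence 2 ^ (k - 1) is at most the
-- number of CNFs plus n times the number of distinct clauses.  Shared clauses are counted
-- only once, so circuits satisfy the same bound, under the weaker hypothesis k² ≤ n.

open import Defs
open import Data.Nat using (ℕ; zero; suc; _+_; _*_; _^_; _≤_; _<_; z≤n; s≤s; _∸_; _!; _/_; NonZero; _≤?_; _≤ᵇ_; _⊓_)
open import Data.Nat.Properties hiding (≡ᵇ⇒≡; _≟_)
open import Data.Nat.Divisibility using (m∣m*n; ∣-trans; m≤n⇒m!∣n!)
open import Data.Nat.DivMod using (m*[n/m]≡n)
open import Data.Nat.Tactic.RingSolver using (solve-∀)
open import Data.Bool using (Bool; true; false; not; _∧_; _∨_; _xor_; if_then_else_; T; _≟_)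
open import Data.Bool.Properties using (not-¬; ¬-not; not-injective; ∧-identityʳ; not-distribˡ-xor; not-distribʳ-xor)
open import Data.Fin using (Fin) renaming (zero to fzero; suc to fsuc)
open import Data.Vec.Functional using (_∷_)
open import Data.List as List using (List; []; length; map; concat; tabulate; take; drop; replicate; _++_)
open import Data.List.Properties using (length-take; length-drop; take++drop≡id; length-++; length-replicate; length-map; length-tabulate; map-∘; map-cong)
open import Data.List.Relation.Unary.Any using (here; there)
open import Data.List.Membership.Propositional using (_∈_)
open import Data.List.Membership.Propositional.Properties using (∈-map⁻; ∈-concat⁺′; ∈-tabulate⁺)
open import Data.Nat.ListAction using (sum; product)
open import Data.Nat.ListAction.Properties using (sum-++; product-++)
open import Data.Bool.ListAction using (any; all; and; or)
open import Data.Product using (_×_; _,_; ∃-syntax; proj₁; proj₂)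
open import Data.Sum using (_⊎_; inj₁; inj₂)
open import Data.Empty using (⊥-elim)
open import Relation.Nullary using (yes; no; contradiction)
open import Relation.Binary.PropositionalEquality
open import Function using (_∘_)

χ : Bool → ℕ
χ true  = 1
χ false = 0

χ≤1 : ∀ b → χ b ≤ 1
χ≤1 true  = ≤-refl
χ≤1 false = z≤n

χ-∧ : ∀ a b → χ (a ∧ b) ≡ χ b * χ a
χ-∧ true  b = sym (*-identityʳ (χ b))
χ-∧ false b = sym (*-zeroʳ (χ b))

χ*≤ : ∀ b m → χ b * m ≤ m
χ*≤ true  m = ≤-reflexive (+-identityʳ m)
χ*≤ false m = z≤n

χ*≢0⇒true : ∀ b m → χ b * m ≢ 0 → b ≡ true
χ*≢0⇒true true  m _ = refl
χ*≢0⇒true false m h = ⊥-elim (h refl)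

isZero : ℕ → Bool
isZero zero    = true
isZero (suc _) = false

isZero⇒≡0 : ∀ m → isZero m ≡ true → m ≡ 0
isZero⇒≡0 zero _ = refl

∧-true-l : ∀ {a b} → (a ∧ b) ≡ true → a ≡ true
∧-true-l {true} _ = refl

∧-true-r : ∀ {a b} → (a ∧ b) ≡ true → b ≡ true
∧-true-r {true} e = e

≤ᵇ-true⇒≤ : ∀ m n → (m ≤ᵇ n) ≡ true → m ≤ n
≤ᵇ-true⇒≤ m n e = ≤ᵇ⇒≤ m n (subst T (sym e) _)

≤ᵇ-false⇒> : ∀ m n → (m ≤ᵇ n) ≡ false → n < m
≤ᵇ-false⇒> m n e = ≰⇒> (λ m≤n → subst T e (≤⇒≤ᵇ m≤n))

^-distribʳ-* : ∀ a b n → (a * b) ^ n ≡ a ^ n * b ^ n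
^-distribʳ-* a b zero    = refl
^-distribʳ-* a b (suc n) rewrite ^-distribʳ-* a b n = interchange a b (a ^ n) (b ^ n)
  where
  interchange : ∀ a b c d → a * b * (c * d) ≡ a * c * (b * d)
  interchange = solve-∀

^-comm-exp : ∀ a m k → (a ^ m) ^ k ≡ (a ^ k) ^ m
^-comm-exp a m k = trans (^-*-assoc a m k) (trans (cong (a ^_) (*-comm m k)) (sym (^-*-assoc a k m)))

^-cancelʳ-≤ : ∀ M .{{_ : NonZero M}} {a b} → a ^ M ≤ b ^ M → a ≤ b
^-cancelʳ-≤ M {a} {b} a^M≤b^M with a ≤? b
... | yes a≤b = a≤b
... | no  a≰b = ⊥-elim (<⇒≱ (^-monoˡ-< M (≰⇒> a≰b)) a^M≤b^M)

factorial-exp : ∀ u f p M → ((u * f) ^ M * 2 ^ p) ^ u ≡ (u ^ u) ^ M * ((f ^ M) ^ u * 2 ^ (u * p))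
factorial-exp u f p M = begin
  ((u * f) ^ M * 2 ^ p) ^ u                 ≡⟨ ^-distribʳ-* ((u * f) ^ M) (2 ^ p) u ⟩
  ((u * f) ^ M) ^ u * (2 ^ p) ^ u           ≡⟨ cong₂ _*_ (cong (_^ u) (^-distribʳ-* u f M)) (trans (^-*-assoc 2 p u) (cong (2 ^_) (*-comm p u))) ⟩
  (u ^ M * f ^ M) ^ u * 2 ^ (u * p)         ≡⟨ cong (_* 2 ^ (u * p)) (^-distribʳ-* (u ^ M) (f ^ M) u) ⟩
  (u ^ M) ^ u * (f ^ M) ^ u * 2 ^ (u * p)   ≡⟨ *-assoc ((u ^ M) ^ u) _ _ ⟩
  (u ^ M) ^ u * ((f ^ M) ^ u * 2 ^ (u * p)) ≡⟨ cong (_* ((f ^ M) ^ u * 2 ^ (u * p))) (^-comm-exp u M u) ⟩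
  (u ^ u) ^ M * ((f ^ M) ^ u * 2 ^ (u * p)) ∎
  where open ≡-Reasoning

n≤2^n : ∀ n → n ≤ 2 ^ n
n≤2^n zero    = z≤n
n≤2^n (suc n) = +-mono-≤ (m^n>0 2 n) (≤-trans (n≤2^n n) (m≤m+n (2 ^ n) 0))

4*ab≤[a+b]²-ordered : ∀ {a b} → a ≤ b → 4 * (a * b) ≤ (a + b) * (a + b)
4*ab≤[a+b]²-ordered {a} a≤b rewrite sym (m+[n∸m]≡n a≤b) = ≤-trans (m≤m+n _ _) (≤-reflexive (square a (_ ∸ a)))
  where
  square : ∀ a d → 4 * (a * (a + d)) + d * d ≡ (a + (a + d)) * (a + (a + d))
  square = solve-∀

4*ab≤[a+b]² : ∀ a b → 4 * (a * b) ≤ (a + b) * (a + b)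
4*ab≤[a+b]² a b with ≤-total a b
... | inj₁ a≤b = 4*ab≤[a+b]²-ordered a≤b
... | inj₂ b≤a rewrite *-comm a b | +-comm a b = 4*ab≤[a+b]²-ordered b≤a

two-branches : ∀ {S₀ S₁ E₀ E₁ K} → S₀ ≤ K → S₁ ≤ K → E₀ ≤ S₀ → E₁ ≤ S₁ →
  (E₀ ≢ 0 → S₁ ≡ 0) → (E₁ ≢ 0 → S₀ ≡ 0) → (S₀ + E₀) + (S₁ + E₁) ≤ 2 * K
two-branches {S₀} {S₁} {zero} {zero} {K} S₀≤K S₁≤K _ _ _ _
  rewrite +-identityʳ S₀ | +-identityʳ S₁ | +-identityʳ K = +-mono-≤ S₀≤K S₁≤K
two-branches {S₀} {S₁} {suc E₀} {E₁} {K} S₀≤K _ E₀≤S₀ E₁≤S₁ excl₀ _ with excl₀ (λ ())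
... | refl rewrite n≤0⇒n≡0 E₁≤S₁ | +-identityʳ (S₀ + suc E₀) | +-identityʳ K = +-mono-≤ S₀≤K (≤-trans E₀≤S₀ S₀≤K)
two-branches {S₀} {S₁} {zero} {suc E₁} {K} _ S₁≤K _ E₁≤S₁ _ excl₁ with excl₁ (λ ())
... | refl rewrite +-identityʳ K = +-mono-≤ S₁≤K (≤-trans E₁≤S₁ S₁≤K)

-- Sums over the Boolean cube
sumCube : ∀ n → (Assignment n → ℕ) → ℕ
sumCube zero    f = f (λ ())
sumCube (suc n) f = sumCube n (f ∘ (false ∷_)) + sumCube n (f ∘ (true ∷_))

count : ∀ n → (Assignment n → Bool) → ℕ
count n P = sumCube n (χ ∘ P)

sumCube-cong : ∀ n {f g : Assignment n → ℕ} → (∀ x → f x ≡ g x) → sumCube n f ≡ sumCube n g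
sumCube-cong zero    h = h _
sumCube-cong (suc n) h = cong₂ _+_ (sumCube-cong n (h ∘ (false ∷_))) (sumCube-cong n (h ∘ (true ∷_)))

sumCube-mono : ∀ n {f g : Assignment n → ℕ} → (∀ x → f x ≤ g x) → sumCube n f ≤ sumCube n g
sumCube-mono zero    h = h _
sumCube-mono (suc n) h = +-mono-≤ (sumCube-mono n (h ∘ (false ∷_))) (sumCube-mono n (h ∘ (true ∷_)))

sumCube-+ : ∀ n (f g : Assignment n → ℕ) → sumCube n (λ x → f x + g x) ≡ sumCube n f + sumCube n g
sumCube-+ zero    f g = refl
sumCube-+ (suc n) f g = trans (cong₂ _+_ (sumCube-+ n _ _) (sumCube-+ n _ _))
  (interchange (sumCube n (f ∘ (false ∷_))) (sumCube n (g ∘ (false ∷_))) (sumCube n (f ∘ (true ∷_))) (sumCube n (g ∘ (true ∷_))))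
  where
  interchange : ∀ a b c d → (a + b) + (c + d) ≡ (a + c) + (b + d)
  interchange = solve-∀

sumCube-*ˡ : ∀ n c (f : Assignment n → ℕ) → sumCube n (λ x → c * f x) ≡ c * sumCube n f
sumCube-*ˡ zero    c f = refl
sumCube-*ˡ (suc n) c f = trans (cong₂ _+_ (sumCube-*ˡ n c _) (sumCube-*ˡ n c _)) (sym (*-distribˡ-+ c _ _))

sumCube-const : ∀ n c → sumCube n (λ _ → c) ≡ c * 2 ^ n
sumCube-const zero    c = sym (*-identityʳ c)
sumCube-const (suc n) c rewrite sumCube-const n c | +-identityʳ (2 ^ n) = sym (*-distribˡ-+ c (2 ^ n) (2 ^ n))

sumCube-zero : ∀ n (f : Assignment n → ℕ) → (∀ x → f x ≡ 0) → sumCube n f ≡ 0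
sumCube-zero zero    f h = h _
sumCube-zero (suc n) f h = cong₂ _+_ (sumCube-zero n _ (h ∘ (false ∷_))) (sumCube-zero n _ (h ∘ (true ∷_)))

sumCube≢0⇒∃ : ∀ n (f : Assignment n → ℕ) → sumCube n f ≢ 0 → ∃[ x ] f x ≢ 0
sumCube≢0⇒∃ zero    f h = _ , h
sumCube≢0⇒∃ (suc n) f h with sumCube n (f ∘ (false ∷_)) in e
... | suc _ = let x , fx≢0 = sumCube≢0⇒∃ n (f ∘ (false ∷_)) (λ e′ → 1+n≢0 (trans (sym e) e′)) in false ∷ x , fx≢0
... | zero  = let x , fx≢0 = sumCube≢0⇒∃ n (f ∘ (true ∷_)) h in true ∷ x , fx≢0

count≤2^n : ∀ n P → count n P ≤ 2 ^ n
count≤2^n n P = ≤-trans (sumCube-mono n (χ≤1 ∘ P)) (≤-reflexive (trans (sumCube-const n 1) (*-identityˡ _)))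

count-none : ∀ n (P : Assignment n → Bool) → (∀ x → P x ≢ true) → count n P ≡ 0
count-none n P h = sumCube-zero n _ λ x → χ-false (P x) (h x)
  where
  χ-false : ∀ b → b ≢ true → χ b ≡ 0
  χ-false true  b≢true = ⊥-elim (b≢true refl)
  χ-false false _      = refl

count-not : ∀ n P → count n P + count n (not ∘ P) ≡ 2 ^ n
count-not n P = trans (sym (sumCube-+ n _ _)) (trans (sumCube-cong n (χ+χnot ∘ P)) (trans (sumCube-const n 1) (*-identityˡ _)))
  where
  χ+χnot : ∀ b → χ b + χ (not b) ≡ 1
  χ+χnot true  = refl
  χ+χnot false = refl

count-parity : ∀ n → count (suc n) (parity (suc n)) ≡ 2 ^ n
count-parity n = count-not n (parity n)

sumFin : ∀ {n} → (Fin n → ℕ) → ℕ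
sumFin {zero}  f = 0
sumFin {suc n} f = f fzero + sumFin (f ∘ fsuc)

prodFin : ∀ {n} → (Fin n → ℕ) → ℕ
prodFin {zero}  f = 1
prodFin {suc n} f = f fzero * prodFin (f ∘ fsuc)

size : ∀ {n} → (Fin n → Bool) → ℕ
size U = sumFin (χ ∘ U)

sumFin-cong : ∀ {n} {f g : Fin n → ℕ} → (∀ i → f i ≡ g i) → sumFin f ≡ sumFin g
sumFin-cong {zero}  h = refl
sumFin-cong {suc n} h = cong₂ _+_ (h fzero) (sumFin-cong (h ∘ fsuc))

sumFin-mono : ∀ {n} {f g : Fin n → ℕ} → (∀ i → f i ≤ g i) → sumFin f ≤ sumFin g
sumFin-mono {zero}  h = z≤n
sumFin-mono {suc n} h = +-mono-≤ (h fzero) (sumFin-mono (h ∘ fsuc))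

sumFin-*ˡ : ∀ {n} c (f : Fin n → ℕ) → sumFin (λ i → c * f i) ≡ c * sumFin f
sumFin-*ˡ {zero}  c f = sym (*-zeroʳ c)
sumFin-*ˡ {suc n} c f = trans (cong (c * f fzero +_) (sumFin-*ˡ c (f ∘ fsuc))) (sym (*-distribˡ-+ c _ _))

sumFin-*ʳ : ∀ {n} (f : Fin n → ℕ) c → sumFin f * c ≡ sumFin (λ i → f i * c)
sumFin-*ʳ {zero}  f c = refl
sumFin-*ʳ {suc n} f c = trans (*-distribʳ-+ c (f fzero) _) (cong (f fzero * c +_) (sumFin-*ʳ (f ∘ fsuc) c))

sumFin-+ : ∀ {n} (f g : Fin n → ℕ) → sumFin (λ i → f i + g i) ≡ sumFin f + sumFin g
sumFin-+ {zero}  f g = refl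
sumFin-+ {suc n} f g rewrite sumFin-+ (f ∘ fsuc) (g ∘ fsuc) =
  interchange (f fzero) (g fzero) (sumFin (f ∘ fsuc)) (sumFin (g ∘ fsuc))
  where
  interchange : ∀ a b c d → a + b + (c + d) ≡ a + c + (b + d)
  interchange = solve-∀

sumFin-const : ∀ n c → sumFin {n} (λ _ → c) ≡ n * c
sumFin-const zero    c = refl
sumFin-const (suc n) c = cong (c +_) (sumFin-const n c)

sumFin≡0 : ∀ {n} (f : Fin n → ℕ) → sumFin f ≡ 0 → ∀ i → f i ≡ 0
sumFin≡0 {suc n} f e fzero    = m+n≡0⇒m≡0 (f fzero) e
sumFin≡0 {suc n} f e (fsuc i) = sumFin≡0 (f ∘ fsuc) (m+n≡0⇒n≡0 (f fzero) e) i

sumFin-swap : ∀ {m n} (f : Fin m → Fin n → ℕ) →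
  sumFin (λ j → sumFin (λ i → f i j)) ≡ sumFin (λ i → sumFin (λ j → f i j))
sumFin-swap {m} {zero}  f = sym (trans (sumFin-const m 0) (*-zeroʳ m))
sumFin-swap {m} {suc n} f = sym (trans (sumFin-+ (λ i → f i fzero) (λ i → sumFin (λ j → f i (fsuc j))))
  (cong (sumFin (λ i → f i fzero) +_) (sym (sumFin-swap (λ i j → f i (fsuc j))))))

sumCube-sumFin : ∀ n {m} (g : Fin m → Assignment n → ℕ) →
  sumCube n (λ x → sumFin (λ j → g j x)) ≡ sumFin (λ j → sumCube n (g j))
sumCube-sumFin n {zero}  g = sumCube-zero n _ (λ _ → refl)
sumCube-sumFin n {suc m} g = trans (sumCube-+ n (g fzero) (λ x → sumFin (λ j → g (fsuc j) x)))
  (cong (sumCube n (g fzero) +_) (sumCube-sumFin n (g ∘ fsuc)))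

prodFin-cong : ∀ {n} {f g : Fin n → ℕ} → (∀ i → f i ≡ g i) → prodFin f ≡ prodFin g
prodFin-cong {zero}  h = refl
prodFin-cong {suc n} h = cong₂ _*_ (h fzero) (prodFin-cong (h ∘ fsuc))

prodFin-mono : ∀ {n} {f g : Fin n → ℕ} → (∀ i → f i ≤ g i) → prodFin f ≤ prodFin g
prodFin-mono {zero}  h = ≤-refl
prodFin-mono {suc n} h = *-mono-≤ (h fzero) (prodFin-mono (h ∘ fsuc))

prodFin-* : ∀ {n} (f g : Fin n → ℕ) → prodFin (λ i → f i * g i) ≡ prodFin f * prodFin g
prodFin-* {zero}  f g = refl
prodFin-* {suc n} f g rewrite prodFin-* (f ∘ fsuc) (g ∘ fsuc) =
  interchange (f fzero) (g fzero) (prodFin (f ∘ fsuc)) (prodFin (g ∘ fsuc))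
  where
  interchange : ∀ a b c d → a * b * (c * d) ≡ a * c * (b * d)
  interchange = solve-∀

prodFin-^ʳ : ∀ {n} c (g : Fin n → ℕ) → prodFin (λ i → c ^ g i) ≡ c ^ sumFin g
prodFin-^ʳ {zero}  c g = refl
prodFin-^ʳ {suc n} c g = trans (cong (c ^ g fzero *_) (prodFin-^ʳ c (g ∘ fsuc))) (sym (^-distribˡ-+-* c (g fzero) _))

prodFin-^ˡ : ∀ {n} (f : Fin n → ℕ) M → prodFin (λ i → f i ^ M) ≡ prodFin f ^ M
prodFin-^ˡ {zero}  f M = sym (^-zeroˡ M)
prodFin-^ˡ {suc n} f M = trans (cong (f fzero ^ M *_) (prodFin-^ˡ (f ∘ fsuc) M)) (sym (^-distribʳ-* (f fzero) (prodFin (f ∘ fsuc)) M))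

_≡ᵇ_ : ∀ {n} → Fin n → Fin n → Bool
fzero  ≡ᵇ fzero  = true
fsuc i ≡ᵇ fsuc j = i ≡ᵇ j
fzero  ≡ᵇ fsuc j = false
fsuc i ≡ᵇ fzero  = false

≡ᵇ-refl : ∀ {n} (i : Fin n) → (i ≡ᵇ i) ≡ true
≡ᵇ-refl fzero    = refl
≡ᵇ-refl (fsuc i) = ≡ᵇ-refl i

≡ᵇ⇒≡ : ∀ {n} {i j : Fin n} → (i ≡ᵇ j) ≡ true → i ≡ j
≡ᵇ⇒≡ {i = fzero}  {fzero}  e = refl
≡ᵇ⇒≡ {i = fsuc i} {fsuc j} e = cong fsuc (≡ᵇ⇒≡ e)

≡ᵇ-sym : ∀ {n} (i j : Fin n) → (i ≡ᵇ j) ≡ (j ≡ᵇ i)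
≡ᵇ-sym fzero    fzero    = refl
≡ᵇ-sym fzero    (fsuc j) = refl
≡ᵇ-sym (fsuc i) fzero    = refl
≡ᵇ-sym (fsuc i) (fsuc j) = ≡ᵇ-sym i j

sumFin-split : ∀ {n} (f : Fin n → ℕ) j → sumFin (λ l → χ (not (l ≡ᵇ j)) * f l) + f j ≡ sumFin f
sumFin-split {suc n} f fzero    = trans (cong (_+ f fzero) (sumFin-cong (λ l → +-identityʳ (f (fsuc l))))) (+-comm _ (f fzero))
sumFin-split {suc n} f (fsuc j) = trans (+-assoc (f fzero + 0) _ _) (cong₂ _+_ (+-identityʳ (f fzero)) (sumFin-split (f ∘ fsuc) j))

size≡0 : ∀ {n} (U : Fin n → Bool) → size U ≡ 0 → ∀ l → U l ≡ false
size≡0 U e l with U l | sumFin≡0 (χ ∘ U) e l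
... | false | _ = refl

size-full : ∀ n → size {n} (λ _ → true) ≡ n
size-full n = trans (sumFin-const n 1) (*-identityʳ n)

remove : ∀ {n} → (Fin n → Bool) → Fin n → (Fin n → Bool)
remove U j l = U l ∧ not (l ≡ᵇ j)

size-remove : ∀ {n} (U : Fin n → Bool) j → U j ≡ true → suc (size (remove U j)) ≡ size U
size-remove U j Uj = trans (+-comm 1 _)
  (trans (cong₂ _+_ (sumFin-cong (λ l → χ-∧ (U l) _)) (cong χ (sym Uj))) (sumFin-split (χ ∘ U) j))

subcube-bound : ∀ n (B : Assignment n → Bool) (S : Fin n → Bool) (q : Assignment n) →
  (∀ x → B x ≡ true → ∀ l → S l ≡ true → x l ≡ q l) → count n B * 2 ^ size S ≤ 2 ^ n
subcube-bound zero    B S q fixed = ≤-trans (≤-reflexive (*-identityʳ _)) (count≤2^n zero B)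
subcube-bound (suc n) B S q fixed = bound (S fzero) refl
  where
  half : ∀ b → count n (B ∘ (b ∷_)) * 2 ^ size (S ∘ fsuc) ≤ 2 ^ n
  half b = subcube-bound n (B ∘ (b ∷_)) (S ∘ fsuc) (q ∘ fsuc) (λ x Bx l Sl → fixed (b ∷ x) Bx (fsuc l) Sl)
  off : S fzero ≡ true → count n (B ∘ (not (q fzero) ∷_)) ≡ 0
  off S₀ = count-none n _ (λ x Bx → not-¬ refl (sym (fixed (not (q fzero) ∷ x) Bx fzero S₀)))
  double : ∀ c s m → c * s ≤ m → c * (2 * s) ≤ 2 * m
  double c s m cs≤m rewrite *-distribˡ-+ c s (s + 0) | +-identityʳ s | +-identityʳ m = +-mono-≤ cs≤m cs≤m
  bound : ∀ s → S fzero ≡ s → count (suc n) B * 2 ^ (χ s + size (S ∘ fsuc)) ≤ 2 ^ suc n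
  bound false _ = ≤-trans (≤-reflexive (*-distribʳ-+ _ (count n (B ∘ (false ∷_))) _))
    (≤-trans (+-mono-≤ (half false) (half true)) (≤-reflexive (cong (2 ^ n +_) (sym (+-identityʳ _)))))
  bound true S₀ with q fzero | off S₀
  ... | true  | none rewrite none = double (count n (B ∘ (true ∷_))) (2 ^ size (S ∘ fsuc)) (2 ^ n) (half true)
  ... | false | none rewrite none | +-identityʳ (count n (B ∘ (false ∷_))) =
    double (count n (B ∘ (false ∷_))) (2 ^ size (S ∘ fsuc)) (2 ^ n) (half false)

-- The AM-GM inequality
sum-map-*ˡ : ∀ u xs → sum (map (u *_) xs) ≡ u * sum xs
sum-map-*ˡ u []            = sym (*-zeroʳ u)
sum-map-*ˡ u (x List.∷ xs) = trans (cong (u * x +_) (sum-map-*ˡ u xs)) (sym (*-distribˡ-+ u x (sum xs)))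

product-map-*ˡ : ∀ u xs → product (map (u *_) xs) ≡ u ^ length xs * product xs
product-map-*ˡ u []            = refl
product-map-*ˡ u (x List.∷ xs) rewrite product-map-*ˡ u xs = regroup u x (u ^ length xs) (product xs)
  where
  regroup : ∀ u x a p → u * x * (a * p) ≡ u * a * (x * p)
  regroup = solve-∀

sum-replicate : ∀ k s → sum (replicate k s) ≡ k * s
sum-replicate zero    s = refl
sum-replicate (suc k) s = cong (s +_) (sum-replicate k s)

product-replicate : ∀ k s → product (replicate k s) ≡ s ^ k
product-replicate zero    s = refl
product-replicate (suc k) s = cong (s *_) (product-replicate k s)

amgm-2^ : ∀ m (xs : List ℕ) → length xs ≡ 2 ^ m → (2 ^ m) ^ (2 ^ m) * product xs ≤ sum xs ^ (2 ^ m)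
amgm-2^ zero (x List.∷ []) _ = ≤-reflexive (singleton x)
  where
  singleton : ∀ x → 1 * (x * 1) ≡ (x + 0) * 1
  singleton = solve-∀
amgm-2^ (suc m) xs len = subst (λ l → (2 * N) ^ (2 * N) * product l ≤ sum l ^ (2 * N)) (take++drop≡id N xs) halves
  where
  N = 2 ^ m
  ys = take N xs
  zs = drop N xs
  len-ys : length ys ≡ N
  len-ys = trans (length-take N xs) (trans (cong (N ⊓_) len) (m≤n⇒m⊓n≡m (m≤m+n N (N + 0))))
  len-zs : length zs ≡ N
  len-zs = trans (length-drop N xs) (trans (cong (_∸ N) len) (trans (cong (λ s → N + s ∸ N) (+-identityʳ N)) (m+n∸m≡n N N)))
  [2N]^2N : (2 * N) ^ (2 * N) ≡ 4 ^ N * (N ^ N * N ^ N)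
  [2N]^2N = trans (sym (^-*-assoc (2 * N) 2 N)) (trans (cong (_^ N) (square N))
              (trans (^-distribʳ-* 4 (N * N) N) (cong (4 ^ N *_) (^-distribʳ-* N N N))))
    where
    square : ∀ N → 2 * N * (2 * N * 1) ≡ 4 * (N * N)
    square = solve-∀
  s^2N : ∀ s → s ^ (2 * N) ≡ (s * s) ^ N
  s^2N s = trans (sym (^-*-assoc s 2 N)) (cong (λ t → (s * t) ^ N) (*-identityʳ s))
  halves : (2 * N) ^ (2 * N) * product (ys ++ zs) ≤ sum (ys ++ zs) ^ (2 * N)
  halves rewrite product-++ ys zs | sum-++ ys zs | [2N]^2N | s^2N (sum ys + sum zs) = begin
    4 ^ N * (N ^ N * N ^ N) * (product ys * product zs)       ≡⟨ regroup (4 ^ N) (N ^ N) (product ys) (product zs) ⟩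
    4 ^ N * ((N ^ N * product ys) * (N ^ N * product zs))     ≤⟨ *-monoʳ-≤ (4 ^ N) (*-mono-≤ (amgm-2^ m ys len-ys) (amgm-2^ m zs len-zs)) ⟩
    4 ^ N * (sum ys ^ N * sum zs ^ N)                         ≡⟨ cong (4 ^ N *_) (^-distribʳ-* (sum ys) (sum zs) N) ⟨
    4 ^ N * (sum ys * sum zs) ^ N                             ≡⟨ ^-distribʳ-* 4 (sum ys * sum zs) N ⟨
    (4 * (sum ys * sum zs)) ^ N                               ≤⟨ ^-monoˡ-≤ N (4*ab≤[a+b]² (sum ys) (sum zs)) ⟩
    ((sum ys + sum zs) * (sum ys + sum zs)) ^ N               ∎
    where
    open ≤-Reasoning
    regroup : ∀ a b c d → a * (b * b) * (c * d) ≡ a * ((b * c) * (b * d))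
    regroup = solve-∀

-- Pad u·xs with copies of the sum to length 2^u and apply the power-of-two case.
amgm : ∀ xs → length xs ^ length xs * product xs ≤ sum xs ^ length xs
amgm [] = ≤-refl
amgm (x List.∷ xs) with sum (x List.∷ xs) in sum≡
... | zero rewrite m+n≡0⇒m≡0 x sum≡ | *-zeroʳ (length (x List.∷ xs) ^ length (x List.∷ xs)) = z≤n
... | suc s = *-cancelʳ-≤ _ _ (S ^ (N ∸ u)) {{m^n≢0 S (N ∸ u)}} padded
  where
  L = x List.∷ xs
  u = length L
  S = suc s
  N = 2 ^ u
  ys = map (u *_) L ++ replicate (N ∸ u) S
  u+[N∸u] : u + (N ∸ u) ≡ N
  u+[N∸u] = m+[n∸m]≡n (n≤2^n u)
  len-ys : length ys ≡ N
  len-ys = trans (length-++ (map (u *_) L)) (trans (cong₂ _+_ (length-map (u *_) L) (length-replicate (N ∸ u))) u+[N∸u])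
  sum-ys : sum ys ≡ N * S
  sum-ys = trans (sum-++ (map (u *_) L) _) (trans (cong₂ _+_ (trans (sum-map-*ˡ u L) (cong (u *_) sum≡)) (sum-replicate (N ∸ u) S))
             (trans (sym (*-distribʳ-+ S u (N ∸ u))) (cong (_* S) u+[N∸u])))
  product-ys : product ys ≡ u ^ u * product L * S ^ (N ∸ u)
  product-ys = trans (product-++ (map (u *_) L) _) (cong₂ _*_ (product-map-*ˡ u L) (product-replicate (N ∸ u) S))
  sum-ys^N : sum ys ^ N ≡ N ^ N * (S ^ u * S ^ (N ∸ u))
  sum-ys^N = trans (cong (_^ N) sum-ys) (trans (^-distribʳ-* N S N)
               (cong (N ^ N *_) (trans (cong (S ^_) (sym u+[N∸u])) (^-distribˡ-+-* S u (N ∸ u)))))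
  padded : u ^ u * product L * S ^ (N ∸ u) ≤ S ^ u * S ^ (N ∸ u)
  padded = *-cancelˡ-≤ (N ^ N) {{m^n≢0 N N {{m^n≢0 2 u}}}}
    (subst₂ (λ p q → N ^ N * p ≤ q) product-ys sum-ys^N (amgm-2^ u ys len-ys))

restrict : ∀ {n} → (Fin n → Bool) → (Fin n → ℕ) → List ℕ
restrict {zero}  U x = []
restrict {suc n} U x with U fzero
... | true  = x fzero List.∷ restrict (U ∘ fsuc) (x ∘ fsuc)
... | false = restrict (U ∘ fsuc) (x ∘ fsuc)

restrict-stats : ∀ {n} U x →
  (length (restrict {n} U x) ≡ size U) ×
  (sum (restrict U x) ≡ sumFin (λ j → χ (U j) * x j)) ×
  (product (restrict U x) ≡ prodFin (λ j → x j ^ χ (U j)))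
restrict-stats {zero}  U x = refl , refl , refl
restrict-stats {suc n} U x with U fzero | restrict-stats (U ∘ fsuc) (x ∘ fsuc)
... | true  | len , Σ , Π = cong suc len , cong₂ _+_ (sym (+-identityʳ (x fzero))) Σ , cong₂ _*_ (sym (*-identityʳ (x fzero))) Π
... | false | len , Σ , Π = len , Σ , trans Π (sym (+-identityʳ _))

amgm-subset : ∀ {n} U x → size {n} U ^ size U * prodFin (λ j → x j ^ χ (U j)) ≤ sumFin (λ j → χ (U j) * x j) ^ size U
amgm-subset U x with restrict-stats U x
... | len , Σ , Π = subst₂ _≤_ (cong₂ (λ l p → l ^ l * p) len Π) (cong₂ _^_ Σ len) (amgm (restrict U x))

prodFin-χ-exp : ∀ {n} (U : Fin n → Bool) C (y : Fin n → ℕ) →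
  prodFin (λ j → (C * 2 ^ y j) ^ χ (U j)) ≡ C ^ size U * 2 ^ sumFin (λ j → χ (U j) * y j)
prodFin-χ-exp U C y = trans (prodFin-cong (λ j → trans (^-distribʳ-* C (2 ^ y j) (χ (U j)))
                        (cong (C ^ χ (U j) *_) (trans (^-*-assoc 2 (y j) (χ (U j))) (cong (2 ^_) (*-comm (y j) (χ (U j))))))))
                      (trans (prodFin-* (λ j → C ^ χ (U j)) (λ j → 2 ^ (χ (U j) * y j)))
                        (cong₂ _*_ (prodFin-^ʳ C (χ ∘ U)) (prodFin-^ʳ 2 (λ j → χ (U j) * y j))))

amgm-exp : ∀ {n} (U : Fin n → Bool) (x y : Fin n → ℕ) C M → (∀ j → U j ≡ true → C * 2 ^ y j ≤ x j ^ M) →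
  (size U ^ size U) ^ M * (C ^ size U * 2 ^ sumFin (λ j → χ (U j) * y j)) ≤ (sumFin (λ j → χ (U j) * x j) ^ size U) ^ M
amgm-exp U x y C M bound = begin
  (u ^ u) ^ M * (C ^ u * 2 ^ sumFin (λ j → χ (U j) * y j))  ≡⟨ cong ((u ^ u) ^ M *_) (prodFin-χ-exp U C y) ⟨
  (u ^ u) ^ M * prodFin (λ j → (C * 2 ^ y j) ^ χ (U j))     ≤⟨ *-monoʳ-≤ ((u ^ u) ^ M) (prodFin-mono termwise) ⟩
  (u ^ u) ^ M * prodFin (λ j → (x j ^ M) ^ χ (U j))         ≡⟨ cong ((u ^ u) ^ M *_) (trans (prodFin-cong (λ j → ^-comm-exp (x j) M (χ (U j))))
                                                                                          (prodFin-^ˡ (λ j → x j ^ χ (U j)) M)) ⟩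
  (u ^ u) ^ M * prodFin (λ j → x j ^ χ (U j)) ^ M           ≡⟨ ^-distribʳ-* (u ^ u) _ M ⟨
  (u ^ u * prodFin (λ j → x j ^ χ (U j))) ^ M               ≤⟨ ^-monoˡ-≤ M (amgm-subset U x) ⟩
  (sumFin (λ j → χ (U j) * x j) ^ u) ^ M                    ∎
  where
  open ≤-Reasoning
  u = size U
  termwise : ∀ j → (C * 2 ^ y j) ^ χ (U j) ≤ (x j ^ M) ^ χ (U j)
  termwise j with U j in Uj
  ... | true  = *-monoˡ-≤ 1 (bound j Uj)
  ... | false = ≤-refl

-- W a i is the set of variables whose values at a determine coordinate i within B (for
-- parity: the variables of a critical clause of i at a).  The argument is that of
-- Paturi–Pudlák–Zane: reveal the variables in a random order, skipping every variable whose
-- witnesses are already revealed.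
module Isolation (n : ℕ) (W : Assignment n → Fin n → Fin n → Bool) where

  Isolated : (Assignment n → Bool) → Set
  Isolated B = ∀ a b i → B a ≡ true → B b ≡ true →
    (∀ l → W a i l ≡ true → (l ≡ᵇ i) ≡ false → b l ≡ a l) → b i ≡ a i

  -- U is the set of variables not yet revealed.
  pending : (Fin n → Bool) → Assignment n → Fin n → Fin n → Bool
  pending U a i l = U l ∧ (W a i l ∧ not (l ≡ᵇ i))

  #pending : (Fin n → Bool) → Assignment n → Fin n → ℕ
  #pending U a i = sumFin (χ ∘ pending U a i)

  forced : (Fin n → Bool) → Assignment n → Fin n → Bool
  forced U a j = isZero (#pending U a j)

  -- Σ over orderings of U of 2 ^ (number of forced variables)
  Ψ : ℕ → (Fin n → Bool) → Assignment n → ℕ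
  Ψ zero    U a = 1
  Ψ (suc t) U a = sumFin (λ j → χ (U j) * (2 ^ χ (forced U a j) * Ψ t (remove U j) a))

  FixedOutside : (Fin n → Bool) → Assignment n → (Assignment n → Bool) → Set
  FixedOutside U p B = ∀ x → B x ≡ true → ∀ l → U l ≡ false → x l ≡ p l

  slice : Fin n → Bool → (Assignment n → Bool) → Assignment n → Bool
  slice j b B x = B x ∧ (if b then x j else not (x j))

  slice⇒≡ : ∀ j b B x → slice j b B x ≡ true → x j ≡ b
  slice⇒≡ j true  B x e = ∧-true-r e
  slice⇒≡ j false B x e with x j | ∧-true-r {B x} e
  ... | false | _ = refl

  χ-split : ∀ B j x → χ (B x) ≡ χ (slice j false B x) + χ (slice j true B x)
  χ-split B j x with B x | x j
  ... | true  | true  = refl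
  ... | true  | false = refl
  ... | false | _     = refl

  forced-determines : ∀ {U p B} j a → FixedOutside U p B → Isolated B → B a ≡ true →
    forced U a j ≡ true → ∀ y → B y ≡ true → y j ≡ a j
  forced-determines {U} {p} j a fixed iso Ba f y By = iso a y j Ba By agree
    where
    none-pending : ∀ l → pending U a j l ≡ false
    none-pending l with pending U a j l | sumFin≡0 (χ ∘ pending U a j) (isZero⇒≡0 _ f) l
    ... | false | _ = refl
    agree : ∀ l → W a j l ≡ true → (l ≡ᵇ j) ≡ false → y l ≡ a l
    agree l w l≢j with U l in Ul | none-pending l
    ... | false | _  = trans (fixed y By l Ul) (sym (fixed a Ba l Ul))
    ... | true  | np rewrite w | l≢j = contradiction np λ ()

  update : Assignment n → Fin n → Bool → Assignment n
  update p j b l = if l ≡ᵇ j then b else p l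

  fixedOutside-slice : ∀ {U p B} j b → FixedOutside U p B → FixedOutside (remove U j) (update p j b) (slice j b B)
  fixedOutside-slice {U} {B = B} j b fixed x Bx l Ul′ with l ≡ᵇ j in l≡j
  ... | true  = trans (cong x (≡ᵇ⇒≡ l≡j)) (slice⇒≡ j b B x Bx)
  ... | false = fixed x (∧-true-l Bx) l (trans (sym (∧-identityʳ (U l))) Ul′)

  isolated-slice : ∀ {B} j b → Isolated B → Isolated (slice j b B)
  isolated-slice j b iso a c i Ba Bc = iso a c i (∧-true-l Ba) (∧-true-l Bc)

  forced-excludes : ∀ {U p B} j b (g : Assignment n → ℕ) → FixedOutside U p B → Isolated B →
    sumCube n (λ x → χ (slice j b B x) * (χ (forced U x j) * g x)) ≢ 0 →
    sumCube n (λ x → χ (slice j (not b) B x) * g x) ≡ 0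
  forced-excludes {U} {p} {B} j b g fixed iso nonzero with sumCube≢0⇒∃ n _ nonzero
  ... | a , summand≢0 = sumCube-zero n (λ x → χ (slice j (not b) B x) * g x) (λ y → vanish y (slice j (not b) B y) refl)
    where
    Ba : slice j b B a ≡ true
    Ba = χ*≢0⇒true _ _ summand≢0
    forced-a : forced U a j ≡ true
    forced-a = χ*≢0⇒true _ (g a) (λ e → summand≢0 (trans (cong (χ (slice j b B a) *_) e) (*-zeroʳ (χ (slice j b B a)))))
    vanish : ∀ y c → slice j (not b) B y ≡ c → χ c * g y ≡ 0
    vanish y false _  = refl
    vanish y true  By = ⊥-elim (not-¬ refl (trans (sym (slice⇒≡ j b B a Ba)) (trans (sym yj≡aj) (slice⇒≡ j (not b) B y By))))
      where
      yj≡aj : y j ≡ a j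
      yj≡aj = forced-determines j a fixed iso (∧-true-l Ba) forced-a y (∧-true-l By)

  branch-bound : ∀ {U p B} t j → FixedOutside U p B → Isolated B →
    (∀ b → sumCube n (λ x → χ (slice j b B x) * Ψ t (remove U j) x) ≤ t ! * 2 ^ t) →
    sumCube n (λ x → χ (B x) * (2 ^ χ (forced U x j) * Ψ t (remove U j) x)) ≤ 2 * (t ! * 2 ^ t)
  branch-bound {U} {p} {B} t j fixed iso ih =
    ≤-trans (≤-reflexive split) (two-branches (ih false) (ih true) (E≤S false) (E≤S true)
      (forced-excludes j false g fixed iso) (forced-excludes j true g fixed iso))
    where
    g : Assignment n → ℕ
    g = Ψ t (remove U j)
    S E : Bool → ℕ
    S b = sumCube n (λ x → χ (slice j b B x) * g x)
    E b = sumCube n (λ x → χ (slice j b B x) * (χ (forced U x j) * g x))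
    E≤S : ∀ b → E b ≤ S b
    E≤S b = sumCube-mono n (λ x → *-monoʳ-≤ (χ (slice j b B x)) (χ*≤ (forced U x j) (g x)))
    2^χ : ∀ b m → 2 ^ χ b * m ≡ m + χ b * m
    2^χ true  = solve-∀
    2^χ false = solve-∀
    expand : ∀ a b c d → (a + b) * (c + d) ≡ (a * c + a * d) + (b * c + b * d)
    expand = solve-∀
    split : sumCube n (λ x → χ (B x) * (2 ^ χ (forced U x j) * g x)) ≡ (S false + E false) + (S true + E true)
    split = trans (sumCube-cong n (λ x → trans (cong₂ _*_ (χ-split B j x) (2^χ (forced U x j) (g x)))
                (expand (χ (slice j false B x)) (χ (slice j true B x)) (g x) (χ (forced U x j) * g x))))
              (trans (sumCube-+ n _ _) (cong₂ _+_ (sumCube-+ n _ _) (sumCube-+ n _ _)))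

  -- For each fixed ordering the forced bits need not be written down, so the points of B
  -- have a prefix-free code and the weights 2 ^ (forced - t) sum to at most 1.
  kraft : ∀ t U p B → size U ≡ t → FixedOutside U p B → Isolated B →
    sumCube n (λ x → χ (B x) * Ψ t U x) ≤ t ! * 2 ^ t
  kraft zero U p B empty fixed iso =
    ≤-trans (≤-reflexive (sumCube-cong n (λ x → *-identityʳ (χ (B x)))))
      (*-cancelʳ-≤ (count n B) 1 (2 ^ n) {{m^n≢0 2 n}} (≤-trans single (≤-reflexive (sym (*-identityˡ _)))))
    where
    single : count n B * 2 ^ n ≤ 2 ^ n
    single = subst (λ s → count n B * 2 ^ s ≤ 2 ^ n) (size-full n)
      (subcube-bound n B (λ _ → true) p (λ x Bx l _ → fixed x Bx l (size≡0 U empty l)))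
  kraft (suc t) U p B size≡ fixed iso = begin
    sumCube n (λ x → χ (B x) * sumFin (λ j → χ (U j) * h j x))   ≡⟨ swap ⟩
    sumFin (λ j → χ (U j) * sumCube n (λ x → χ (B x) * h j x))   ≤⟨ sumFin-mono branch ⟩
    sumFin (λ j → χ (U j) * (2 * K))                             ≡⟨ sumFin-cong (λ j → *-comm (χ (U j)) (2 * K)) ⟩
    sumFin (λ j → 2 * K * χ (U j))                               ≡⟨ sumFin-*ˡ (2 * K) (χ ∘ U) ⟩
    2 * K * size U                                               ≡⟨ cong (2 * K *_) size≡ ⟩
    2 * (t ! * 2 ^ t) * suc t                                    ≡⟨ regroup t (t !) (2 ^ t) ⟩
    suc t ! * 2 ^ suc t                                          ∎
    where
    open ≤-Reasoning
    K = t ! * 2 ^ t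
    h : Fin n → Assignment n → ℕ
    h j x = 2 ^ χ (forced U x j) * Ψ t (remove U j) x
    regroup : ∀ t f q → 2 * (f * q) * suc t ≡ (suc t * f) * (2 * q)
    regroup = solve-∀
    exchange : ∀ a b c → a * (b * c) ≡ b * (a * c)
    exchange = solve-∀
    swap : sumCube n (λ x → χ (B x) * sumFin (λ j → χ (U j) * h j x))
         ≡ sumFin (λ j → χ (U j) * sumCube n (λ x → χ (B x) * h j x))
    swap = trans (sumCube-cong n (λ x → trans (sym (sumFin-*ˡ (χ (B x)) (λ j → χ (U j) * h j x)))
                                              (sumFin-cong (λ j → exchange (χ (B x)) (χ (U j)) (h j x)))))
             (trans (sumCube-sumFin n (λ j x → χ (U j) * (χ (B x) * h j x)))
               (sumFin-cong (λ j → sumCube-*ˡ n (χ (U j)) (λ x → χ (B x) * h j x))))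
    branch : ∀ j → χ (U j) * sumCube n (λ x → χ (B x) * h j x) ≤ χ (U j) * (2 * K)
    branch j with U j in Uj
    ... | false = z≤n
    ... | true  = *-monoʳ-≤ 1 (branch-bound t j fixed iso (λ b →
      kraft t (remove U j) (update p j b) (slice j b B) (suc-injective (trans (size-remove U j Uj) size≡))
        (fixedOutside-slice j b fixed) (isolated-slice j b iso)))

  pending-remove : ∀ U a i j l → χ (pending (remove U j) a i l) ≡ χ (not (l ≡ᵇ j)) * χ (pending U a i l)
  pending-remove U a i j l with U l | l ≡ᵇ j | W a i l | l ≡ᵇ i
  ... | true  | true  | _     | _     = refl
  ... | true  | false | true  | true  = refl
  ... | true  | false | true  | false = refl
  ... | true  | false | false | _     = refl
  ... | false | true  | _     | _     = refl
  ... | false | false | _     | _     = refl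

  #pending-remove : ∀ U a i j → #pending (remove U j) a i + χ (pending U a i j) ≡ #pending U a i
  #pending-remove U a i j = trans (cong (_+ χ (pending U a i j)) (sumFin-cong (pending-remove U a i j)))
                                  (sumFin-split (χ ∘ pending U a i) j)

  others : (Fin n → Bool) → Fin n → Fin n → Bool
  others U i j = U j ∧ not (j ≡ᵇ i)

  pending⇒others : ∀ U a i j → pending U a i j ≡ true → others U i j ≡ true
  pending⇒others U a i j e with U j | W a i j | j ≡ᵇ i
  ... | true | true | false = refl

  size-others : ∀ U i t → size U ≡ suc t → U i ≡ true → sumFin (χ ∘ others U i) ≡ t
  size-others U i t size≡ Ui = suc-injective (trans (+-comm 1 _)
    (trans (cong₂ _+_ (sumFin-cong (λ l → χ-∧ (U l) (not (l ≡ᵇ i)))) (cong χ (sym Ui)))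
      (trans (sumFin-split (χ ∘ U) i) size≡)))

  -- ψ c is M times the probability that a variable with c pending witnesses comes after all
  -- of them in a random ordering; M = (w + 1)! makes the division exact for c ≤ w.
  module Averaging (w : ℕ) where

    M : ℕ
    M = suc w !

    ψ : ℕ → ℕ
    ψ c = M / suc c

    ψ-exact : ∀ c → c ≤ w → suc c * ψ c ≡ M
    ψ-exact c c≤w = m*[n/m]≡n (∣-trans (m∣m*n (c !)) (m≤n⇒m!∣n! (s≤s c≤w)))

    ψ-antitone : ∀ c → c ≤ w → ψ w ≤ ψ c
    ψ-antitone c c≤w with ψ w ≤? ψ c
    ... | yes ψw≤ψc = ψw≤ψc
    ... | no  ψw≰ψc = ⊥-elim (<-irrefl (ψ-exact c c≤w) (begin-strict
      suc c * ψ c  ≤⟨ *-monoˡ-≤ (ψ c) (s≤s c≤w) ⟩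
      suc w * ψ c  <⟨ *-monoʳ-< (suc w) (≰⇒> ψw≰ψc) ⟩
      suc w * ψ w  ≡⟨ ψ-exact w ≤-refl ⟩
      M            ∎))
      where open ≤-Reasoning

    φ : (Fin n → Bool) → Assignment n → ℕ
    φ U a = sumFin (λ i → χ (U i) * ψ (#pending U a i))

    Bounded : (Fin n → Bool) → Assignment n → Set
    Bounded U a = ∀ i → U i ≡ true → #pending U a i ≤ w

    bounded-remove : ∀ U a j → Bounded U a → Bounded (remove U j) a
    bounded-remove U a j bounded i Ui = ≤-trans (m≤m+n _ _)
      (≤-trans (≤-reflexive (#pending-remove U a i j)) (bounded i (∧-true-l Ui)))

    ψ-recurrence-pending : ∀ U a i t c → size U ≡ suc t → U i ≡ true → #pending U a i ≡ suc c → suc c ≤ w →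
      sumFin (λ j → χ (others U i j) * ψ (#pending (remove U j) a i)) ≡ suc t * ψ (suc c)
    ψ-recurrence-pending U a i t c size≡ Ui c≡ c≤w = +-cancelʳ-≡ (suc c * ψ (suc c)) _ _ (begin
      sumFin R + suc c * ψ (suc c)
        ≡⟨ cong (sumFin R +_) (trans (cong (_* ψ (suc c)) (sym c≡)) (sumFin-*ʳ (χ ∘ pending U a i) (ψ (suc c)))) ⟩
      sumFin R + sumFin (λ j → χ (pending U a i j) * ψ (suc c))
        ≡⟨ sumFin-+ R (λ j → χ (pending U a i j) * ψ (suc c)) ⟨
      sumFin (λ j → R j + χ (pending U a i j) * ψ (suc c))
        ≡⟨ sumFin-cong per-j ⟩
      sumFin (λ j → χ (others U i j) * ψ (suc c) + χ (pending U a i j) * ψ c)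
        ≡⟨ sumFin-+ (λ j → χ (others U i j) * ψ (suc c)) (λ j → χ (pending U a i j) * ψ c) ⟩
      sumFin (λ j → χ (others U i j) * ψ (suc c)) + sumFin (λ j → χ (pending U a i j) * ψ c)
        ≡⟨ cong₂ _+_ (sym (sumFin-*ʳ (χ ∘ others U i) (ψ (suc c)))) (sym (sumFin-*ʳ (χ ∘ pending U a i) (ψ c))) ⟩
      sumFin (χ ∘ others U i) * ψ (suc c) + #pending U a i * ψ c
        ≡⟨ cong₂ _+_ (cong (_* ψ (suc c)) (size-others U i t size≡ Ui))
                     (trans (cong (_* ψ c) c≡) (ψ-exact c (≤-trans (n≤1+n c) c≤w))) ⟩
      t * ψ (suc c) + M
        ≡⟨ cong (t * ψ (suc c) +_) (ψ-exact (suc c) c≤w) ⟨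
      t * ψ (suc c) + (ψ (suc c) + suc c * ψ (suc c))
        ≡⟨ +-assoc (t * ψ (suc c)) _ _ ⟨
      t * ψ (suc c) + ψ (suc c) + suc c * ψ (suc c)
        ≡⟨ cong (_+ suc c * ψ (suc c)) (+-comm (t * ψ (suc c)) _) ⟩
      suc t * ψ (suc c) + suc c * ψ (suc c) ∎)
      where
      open ≡-Reasoning
      R : Fin n → ℕ
      R j = χ (others U i j) * ψ (#pending (remove U j) a i)
      per-j : ∀ j → R j + χ (pending U a i j) * ψ (suc c) ≡ χ (others U i j) * ψ (suc c) + χ (pending U a i j) * ψ c
      per-j j with pending U a i j in p | #pending-remove U a i j
      ... | true  | r rewrite pending⇒others U a i j p =
        trans (cong (λ m → (ψ m + 0) + (ψ (suc c) + 0)) (suc-injective (trans (+-comm 1 _) (trans r c≡)))) (+-comm (ψ c + 0) _)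
      ... | false | r = cong (λ m → χ (others U i j) * ψ m + 0) (trans (sym (+-identityʳ _)) (trans r c≡))

    -- Each j ≠ i removed first leaves i with one pending witness fewer exactly when j is one.
    ψ-recurrence : ∀ U a i t → size U ≡ suc t → U i ≡ true → Bounded U a →
      M * χ (forced U a i) + sumFin (λ j → χ (others U i j) * ψ (#pending (remove U j) a i)) ≡ suc t * ψ (#pending U a i)
    ψ-recurrence U a i t size≡ Ui bounded with #pending U a i in c≡
    ... | suc c = trans (cong (_+ sumFin (λ j → χ (others U i j) * ψ (#pending (remove U j) a i))) (*-zeroʳ M))
                        (ψ-recurrence-pending U a i t c size≡ Ui c≡ (subst (_≤ w) c≡ (bounded i Ui)))
    ... | zero  = begin
      M * 1 + sumFin (λ j → χ (others U i j) * ψ (#pending (remove U j) a i))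
        ≡⟨ cong₂ _+_ (*-identityʳ M) (sumFin-cong (λ j → cong (λ m → χ (others U i j) * ψ m)
             (m+n≡0⇒m≡0 _ (trans (#pending-remove U a i j) c≡)))) ⟩
      M + sumFin (λ j → χ (others U i j) * ψ 0)
        ≡⟨ cong₂ _+_ (sym (trans (sym (+-identityʳ (ψ 0))) (ψ-exact 0 z≤n))) (trans (sym (sumFin-*ʳ (χ ∘ others U i) (ψ 0)))
                                                                        (cong (_* ψ 0) (size-others U i t size≡ Ui))) ⟩
      ψ 0 + t * ψ 0 ∎
      where open ≡-Reasoning

    χ-remove-swap : ∀ (U : Fin n → Bool) i j → χ (U j) * χ (remove U j i) ≡ χ (U i) * χ (others U i j)
    χ-remove-swap U i j = trans (swap (U i) (U j) (i ≡ᵇ j)) (cong (λ b → χ (U i) * χ (U j ∧ not b)) (≡ᵇ-sym i j))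
      where
      swap : ∀ u v b → χ v * χ (u ∧ not b) ≡ χ u * χ (v ∧ not b)
      swap true  true  b = refl
      swap true  false b = refl
      swap false true  b = refl
      swap false false b = refl

    φ-remove-double-count : ∀ U a → sumFin (λ j → χ (U j) * φ (remove U j) a)
      ≡ sumFin (λ i → χ (U i) * sumFin (λ j → χ (others U i j) * ψ (#pending (remove U j) a i)))
    φ-remove-double-count U a = begin
      sumFin (λ j → χ (U j) * φ (remove U j) a)
        ≡⟨ sumFin-cong (λ j → sumFin-*ˡ (χ (U j)) (λ i → χ (remove U j i) * ψ′ i j)) ⟨
      sumFin (λ j → sumFin (λ i → χ (U j) * (χ (remove U j i) * ψ′ i j)))
        ≡⟨ sumFin-swap (λ i j → χ (U j) * (χ (remove U j i) * ψ′ i j)) ⟩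
      sumFin (λ i → sumFin (λ j → χ (U j) * (χ (remove U j i) * ψ′ i j)))
        ≡⟨ sumFin-cong (λ i → sumFin-cong (λ j → regroup i j)) ⟩
      sumFin (λ i → sumFin (λ j → χ (U i) * (χ (others U i j) * ψ′ i j)))
        ≡⟨ sumFin-cong (λ i → sumFin-*ˡ (χ (U i)) (λ j → χ (others U i j) * ψ′ i j)) ⟩
      sumFin (λ i → χ (U i) * sumFin (λ j → χ (others U i j) * ψ′ i j)) ∎
      where
      open ≡-Reasoning
      ψ′ : Fin n → Fin n → ℕ
      ψ′ i j = ψ (#pending (remove U j) a i)
      regroup : ∀ i j → χ (U j) * (χ (remove U j i) * ψ′ i j) ≡ χ (U i) * (χ (others U i j) * ψ′ i j)
      regroup i j = trans (sym (*-assoc (χ (U j)) _ _))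
                      (trans (cong (_* ψ′ i j) (χ-remove-swap U i j)) (*-assoc (χ (U i)) _ _))

    φ-recurrence : ∀ U a t → size U ≡ suc t → Bounded U a →
      sumFin (λ j → χ (U j) * (M * χ (forced U a j) + φ (remove U j) a)) ≡ suc t * φ U a
    φ-recurrence U a t size≡ bounded = begin
      sumFin (λ j → χ (U j) * (M * χ (forced U a j) + φ (remove U j) a))
        ≡⟨ sumFin-cong (λ j → *-distribˡ-+ (χ (U j)) _ _) ⟩
      sumFin (λ j → χ (U j) * (M * χ (forced U a j)) + χ (U j) * φ (remove U j) a)
        ≡⟨ sumFin-+ (λ j → χ (U j) * (M * χ (forced U a j))) _ ⟩
      sumFin (λ j → χ (U j) * (M * χ (forced U a j))) + sumFin (λ j → χ (U j) * φ (remove U j) a)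
        ≡⟨ cong (sumFin (λ j → χ (U j) * (M * χ (forced U a j))) +_) (φ-remove-double-count U a) ⟩
      sumFin (λ i → χ (U i) * (M * χ (forced U a i))) + sumFin (λ i → χ (U i) * inner i)
        ≡⟨ sumFin-+ (λ i → χ (U i) * (M * χ (forced U a i))) _ ⟨
      sumFin (λ i → χ (U i) * (M * χ (forced U a i)) + χ (U i) * inner i)
        ≡⟨ sumFin-cong (λ i → trans (sym (*-distribˡ-+ (χ (U i)) _ _)) (per-i i)) ⟩
      sumFin (λ i → suc t * (χ (U i) * ψ (#pending U a i)))
        ≡⟨ sumFin-*ˡ (suc t) (λ i → χ (U i) * ψ (#pending U a i)) ⟩
      suc t * φ U a ∎
      where
      open ≡-Reasoning
      inner : Fin n → ℕ
      inner i = sumFin (λ j → χ (others U i j) * ψ (#pending (remove U j) a i))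
      per-i : ∀ i → χ (U i) * (M * χ (forced U a i) + inner i) ≡ suc t * (χ (U i) * ψ (#pending U a i))
      per-i i with U i in Ui
      ... | false = sym (*-zeroʳ (suc t))
      ... | true  = trans (*-identityˡ _) (trans (ψ-recurrence U a i t size≡ Ui bounded) (cong (suc t *_) (sym (*-identityˡ _))))

    φ-empty : ∀ U a → size U ≡ 0 → φ U a ≡ 0
    φ-empty U a empty = trans (sumFin-cong (λ i → cong (λ b → χ b * ψ (#pending U a i)) (size≡0 U empty i)))
                              (trans (sumFin-const n 0) (*-zeroʳ n))

    -- Jensen's inequality E[2 ^ forced] ≥ 2 ^ E[forced] over the orderings of U, raised to
    -- the M-th power so that everything stays integral.
    jensen : ∀ t U a → size U ≡ t → Bounded U a → (t !) ^ M * 2 ^ φ U a ≤ Ψ t U a ^ M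
    jensen zero U a empty _ rewrite φ-empty U a empty = ≤-reflexive (*-identityʳ _)
    jensen (suc t) U a size≡ bounded = ^-cancelʳ-≤ (suc t) (begin
      ((suc t !) ^ M * 2 ^ φ U a) ^ suc t
        ≡⟨ factorial-exp (suc t) (t !) (φ U a) M ⟩
      (suc t ^ suc t) ^ M * (C ^ suc t * 2 ^ (suc t * φ U a))
        ≡⟨ cong (λ e → (suc t ^ suc t) ^ M * (C ^ suc t * 2 ^ e)) (φ-recurrence U a t size≡ bounded) ⟨
      (suc t ^ suc t) ^ M * (C ^ suc t * 2 ^ sumFin (λ j → χ (U j) * y j))
        ≤⟨ subst (λ s → (s ^ s) ^ M * (C ^ s * 2 ^ sumFin (λ j → χ (U j) * y j)) ≤ (Ψ (suc t) U a ^ s) ^ M)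
                 size≡ (amgm-exp U x y C M termwise) ⟩
      (Ψ (suc t) U a ^ suc t) ^ M
        ≡⟨ ^-comm-exp _ (suc t) M ⟩
      (Ψ (suc t) U a ^ M) ^ suc t ∎)
      where
      open ≤-Reasoning
      C = (t !) ^ M
      x y : Fin n → ℕ
      x j = 2 ^ χ (forced U a j) * Ψ t (remove U j) a
      y j = M * χ (forced U a j) + φ (remove U j) a
      exchange : ∀ a b c → a * (b * c) ≡ b * (a * c)
      exchange = solve-∀
      termwise : ∀ j → U j ≡ true → C * 2 ^ y j ≤ x j ^ M
      termwise j Uj = begin
        C * 2 ^ (M * f + φ (remove U j) a)       ≡⟨ cong (C *_) (^-distribˡ-+-* 2 (M * f) (φ (remove U j) a)) ⟩
        C * (2 ^ (M * f) * 2 ^ φ (remove U j) a) ≡⟨ exchange C (2 ^ (M * f)) (2 ^ φ (remove U j) a) ⟩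
        2 ^ (M * f) * (C * 2 ^ φ (remove U j) a) ≤⟨ *-monoʳ-≤ (2 ^ (M * f)) ih ⟩
        2 ^ (M * f) * Ψ t (remove U j) a ^ M     ≡⟨ cong (_* Ψ t (remove U j) a ^ M) (trans (cong (2 ^_) (*-comm M f)) (sym (^-*-assoc 2 f M))) ⟩
        (2 ^ f) ^ M * Ψ t (remove U j) a ^ M     ≡⟨ ^-distribʳ-* (2 ^ f) _ M ⟨
        x j ^ M                                  ∎
        where
        f = χ (forced U a j)
        ih = jensen t (remove U j) a (suc-injective (trans (size-remove U j Uj) size≡)) (bounded-remove U a j bounded)

    φ-full-lower : ∀ a → (∀ i → #pending (λ _ → true) a i ≤ w) → suc w * suc w ≤ n → suc w * M ≤ φ (λ _ → true) a
    φ-full-lower a bounded k²≤n = begin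
      suc w * M                     ≡⟨ cong (suc w *_) (ψ-exact w ≤-refl) ⟨
      suc w * (suc w * ψ w)         ≡⟨ *-assoc (suc w) (suc w) (ψ w) ⟨
      suc w * suc w * ψ w           ≤⟨ *-monoˡ-≤ (ψ w) k²≤n ⟩
      n * ψ w                       ≡⟨ sumFin-const n (ψ w) ⟨
      sumFin {n} (λ _ → ψ w)        ≤⟨ sumFin-mono (λ i → ≤-trans (ψ-antitone _ (bounded i)) (≤-reflexive (sym (+-identityʳ _)))) ⟩
      φ (λ _ → true) a              ∎
      where open ≤-Reasoning

  isolated-bound : ∀ w B → Isolated B → (∀ a → B a ≡ true → ∀ i → #pending (λ _ → true) a i ≤ w) →
    suc w * suc w ≤ n → count n B * 2 ^ suc w ≤ 2 ^ n
  isolated-bound w B iso bounded k²≤n = *-cancelˡ-≤ (n !) {{n !≢0}} (begin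
    n ! * (count n B * 2 ^ k)                       ≡⟨ exchange (n !) (count n B) (2 ^ k) ⟩
    count n B * (n ! * 2 ^ k)                       ≡⟨ trans (sumCube-*ˡ n (n ! * 2 ^ k) (χ ∘ B)) (*-comm (n ! * 2 ^ k) (count n B)) ⟨
    sumCube n (λ x → (n ! * 2 ^ k) * χ (B x))       ≤⟨ sumCube-mono n pointwise ⟩
    sumCube n (λ x → χ (B x) * Ψ n full x)          ≤⟨ kraft n full (λ _ → false) B (size-full n) (λ _ _ _ ()) iso ⟩
    n ! * 2 ^ n                                     ∎)
    where
    open Averaging w
    open ≤-Reasoning
    k = suc w
    full : Fin n → Bool
    full _ = true
    exchange : ∀ a b c → a * (b * c) ≡ b * (a * c)
    exchange = solve-∀
    ψ-large : ∀ a → B a ≡ true → n ! * 2 ^ k ≤ Ψ n full a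
    ψ-large a Ba = ^-cancelʳ-≤ M {{suc w !≢0}} (begin
      (n ! * 2 ^ k) ^ M       ≡⟨ ^-distribʳ-* (n !) (2 ^ k) M ⟩
      (n !) ^ M * (2 ^ k) ^ M ≡⟨ cong ((n !) ^ M *_) (^-*-assoc 2 k M) ⟩
      (n !) ^ M * 2 ^ (k * M) ≤⟨ *-monoʳ-≤ ((n !) ^ M) (^-monoʳ-≤ 2 (φ-full-lower a (bounded a Ba) k²≤n)) ⟩
      (n !) ^ M * 2 ^ φ full a ≤⟨ jensen n full a (size-full n) (λ i _ → bounded a Ba i) ⟩
      Ψ n full a ^ M          ∎)
    pointwise : ∀ x → (n ! * 2 ^ k) * χ (B x) ≤ χ (B x) * Ψ n full x
    pointwise x with B x in Bx
    ... | false = ≤-reflexive (*-zeroʳ (n ! * 2 ^ k))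
    ... | true  = ≤-trans (≤-reflexive (*-identityʳ _)) (≤-trans (ψ-large x Bx) (≤-reflexive (sym (*-identityˡ _))))

-- Clauses, critical clauses and parity
flipAt : ∀ {n} → Fin n → Assignment n → Assignment n
flipAt i x j = if i ≡ᵇ j then not (x j) else x j

parity-flipAt : ∀ n i (x : Assignment n) → parity n (flipAt i x) ≡ not (parity n x)
parity-flipAt (suc n) fzero    x = sym (not-distribˡ-xor (x fzero) (parity n (x ∘ fsuc)))
parity-flipAt (suc n) (fsuc i) x = trans (cong (x fzero xor_) (parity-flipAt n i (x ∘ fsuc))) (sym (not-distribʳ-xor (x fzero) _))

flipAt-same : ∀ {n} i (x : Assignment n) → flipAt i x i ≡ not (x i)
flipAt-same i x rewrite ≡ᵇ-refl i = refl

flipAt-other : ∀ {n} i l (x : Assignment n) → (i ≡ᵇ l) ≡ false → flipAt i x l ≡ x l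
flipAt-other i l x i≢l rewrite i≢l = refl

mentions : ∀ {n} → Clause n → Fin n → Bool
mentions c l = any (λ lit → proj₁ lit ≡ᵇ l) c

-- meaningful only on the variables of c, where it is the unique assignment falsifying c
falsifier : ∀ {n} → Clause n → Assignment n
falsifier []            l = false
falsifier ((v , p) List.∷ c) l = if v ≡ᵇ l then not p else falsifier c l

width : ∀ {n} → Clause n → Fin n → ℕ
width c i = sumFin (λ l → χ (mentions c l ∧ not (l ≡ᵇ i)))

evalClause-cong : ∀ {n} (x y : Assignment n) c → (∀ l → mentions c l ≡ true → x l ≡ y l) → evalClause x c ≡ evalClause y c
evalClause-cong x y []                 agree = refl
evalClause-cong x y ((v , p) List.∷ c) agree =
  cong₂ _∨_ (literal p (agree v (cong (_∨ mentions c v) (≡ᵇ-refl v))))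
            (evalClause-cong x y c (λ l m → agree l (∨-true-r (v ≡ᵇ l) m)))
  where
  literal : ∀ p → x v ≡ y v → evalLit x (v , p) ≡ evalLit y (v , p)
  literal true  e = e
  literal false e = cong not e
  ∨-true-r : ∀ a {b} → b ≡ true → (a ∨ b) ≡ true
  ∨-true-r true  _ = refl
  ∨-true-r false e = e

falsified⇒falsifier : ∀ {n} (y : Assignment n) c → evalClause y c ≡ false →
  ∀ l → mentions c l ≡ true → y l ≡ falsifier c l
falsified⇒falsifier y ((v , p) List.∷ c) false≡ l m with v ≡ᵇ l in v≡l | evalLit y (v , p) in lit
... | true  | false = trans (cong y (sym (≡ᵇ⇒≡ v≡l))) (literal p lit)
  where
  literal : ∀ p → evalLit y (v , p) ≡ false → y v ≡ not p
  literal true  e = e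
  literal false e with y v
  ... | true = refl
... | false | false = falsified⇒falsifier y c false≡ l m

any⇒∃ : ∀ {A : Set} (p : A → Bool) L → any p L ≡ true → ∃[ x ] (x ∈ L × p x ≡ true)
any⇒∃ p (x List.∷ L) e with p x in px
... | true  = x , here refl , px
... | false = let y , y∈L , py = any⇒∃ p L e in y , there y∈L , py

∈⇒any : ∀ {A : Set} (p : A → Bool) {L x} → x ∈ L → p x ≡ true → any p L ≡ true
∈⇒any p (here refl) px rewrite px = refl
∈⇒any p {y List.∷ L} (there x∈L) px with p y
... | true  = refl
... | false = ∈⇒any p x∈L px

all≡false⇒∃ : ∀ {A : Set} (p : A → Bool) L → all p L ≡ false → ∃[ x ] (x ∈ L × p x ≡ false)
all≡false⇒∃ p (x List.∷ L) e with p x in px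
... | false = x , here refl , px
... | true  = let y , y∈L , py = all≡false⇒∃ p L e in y , there y∈L , py

any≡false⇒ : ∀ {A : Set} (p : A → Bool) {L x} → any p L ≡ false → x ∈ L → p x ≡ false
any≡false⇒ p {L} {x} e x∈L with p x in px
... | false = refl
... | true  = trans (sym (∈⇒any p x∈L px)) e

χ-any≤sum : ∀ {A : Set} (p : A → Bool) L → χ (any p L) ≤ sum (map (χ ∘ p) L)
χ-any≤sum p []           = z≤n
χ-any≤sum p (x List.∷ L) with p x
... | true  = s≤s z≤n
... | false = χ-any≤sum p L

first : ∀ {A : Set} → (A → Bool) → A → List A → A
first p d []           = d
first p d (c List.∷ L) = if p c then c else first p d L

first-satisfies : ∀ {A : Set} (p q : A → Bool) d L → any p L ≡ true → all q L ≡ true →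
  p (first p d L) ≡ true × q (first p d L) ≡ true
first-satisfies p q d (c List.∷ L) anyp allq with p c in pc
... | true  = pc , ∧-true-l allq
... | false = first-satisfies p q d L anyp (∧-true-r {q c} allq)

sum-map-bound : ∀ {A : Set} (f : A → ℕ) c L → (∀ a → f a ≤ c) → sum (map f L) ≤ length L * c
sum-map-bound f c []           h = z≤n
sum-map-bound f c (a List.∷ L) h = +-mono-≤ (h a) (sum-map-bound f c L h)

sum-map-*ʳ : ∀ {A : Set} (f : A → ℕ) c L → sum (map f L) * c ≡ sum (map (λ a → f a * c) L)
sum-map-*ʳ f c []           = refl
sum-map-*ʳ f c (a List.∷ L) = trans (*-distribʳ-+ c (f a) _) (cong (f a * c +_) (sum-map-*ʳ f c L))

sumCube-sum : ∀ n {A : Set} (g : A → Assignment n → ℕ) L →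
  sumCube n (λ x → sum (map (λ a → g a x) L)) ≡ sum (map (λ a → sumCube n (g a)) L)
sumCube-sum n g []           = sumCube-zero n _ (λ _ → refl)
sumCube-sum n g (a List.∷ L) = trans (sumCube-+ n (g a) _) (cong (sumCube n (g a) +_) (sumCube-sum n g L))

anyᶠ : ∀ {n} → (Fin n → Bool) → Bool
anyᶠ {zero}  P = false
anyᶠ {suc n} P = P fzero ∨ anyᶠ (P ∘ fsuc)

allᶠ : ∀ {n} → (Fin n → Bool) → Bool
allᶠ {zero}  P = true
allᶠ {suc n} P = P fzero ∧ allᶠ (P ∘ fsuc)

allᶠ⇒ : ∀ {n} (P : Fin n → Bool) → allᶠ P ≡ true → ∀ i → P i ≡ true
allᶠ⇒ {suc n} P e fzero    = ∧-true-l e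
allᶠ⇒ {suc n} P e (fsuc i) = allᶠ⇒ (P ∘ fsuc) (∧-true-r {P fzero} e) i

allᶠ≡false⇒∃ : ∀ {n} (P : Fin n → Bool) → allᶠ P ≡ false → ∃[ i ] P i ≡ false
allᶠ≡false⇒∃ {suc n} P e with P fzero in p₀
... | false = fzero , p₀
... | true  = let i , Pi = allᶠ≡false⇒∃ (P ∘ fsuc) e in fsuc i , Pi

⇒anyᶠ : ∀ {n} (P : Fin n → Bool) i → P i ≡ true → anyᶠ P ≡ true
⇒anyᶠ P fzero    e rewrite e = refl
⇒anyᶠ P (fsuc i) e with P fzero
... | true  = refl
... | false = ⇒anyᶠ (P ∘ fsuc) i e

χ-anyᶠ≤sumFin : ∀ {n} (P : Fin n → Bool) → χ (anyᶠ P) ≤ sumFin (χ ∘ P)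
χ-anyᶠ≤sumFin {zero}  P = z≤n
χ-anyᶠ≤sumFin {suc n} P with P fzero
... | true  = s≤s z≤n
... | false = χ-anyᶠ≤sumFin (P ∘ fsuc)

-- A clause c of a CNF accepting x is critical for i at x if it is falsified by flipping
-- x i; every CNF accepting a point of odd parity has a critical clause for each i.
module Critical (n w : ℕ) where

  shortCritical : Assignment n → Fin n → Clause n → Bool
  shortCritical x i c = not (evalClause (flipAt i x) c) ∧ (width c i ≤ᵇ w)

  longCritical : Clause n → Fin n → Assignment n → Bool
  longCritical c i x = not (evalClause (flipAt i x) c) ∧ not (width c i ≤ᵇ w)

  AllShort : List (Clause n) → Assignment n → Bool
  AllShort D x = all (evalClause x) D ∧ allᶠ (λ i → any (shortCritical x i) D)

  SomeLong : Clause n → Assignment n → Bool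
  SomeLong c x = anyᶠ (λ i → longCritical c i x)

  witness : List (Clause n) → Assignment n → Fin n → Fin n → Bool
  witness D a i = mentions (first (shortCritical a i) [] D)

  witness-critical : ∀ D a i → AllShort D a ≡ true → ∀ {q} → all q D ≡ true →
    shortCritical a i (first (shortCritical a i) [] D) ≡ true × q (first (shortCritical a i) [] D) ≡ true
  witness-critical D a i allShort allq =
    first-satisfies (shortCritical a i) _ [] D (allᶠ⇒ _ (∧-true-r {all (evalClause a) D} allShort) i) allq

  allShort-isolated : ∀ D → Isolation.Isolated n (witness D) (AllShort D)
  allShort-isolated D a b i Da Db agree with b i ≟ a i
  ... | yes bi≡ai = bi≡ai
  ... | no  bi≢ai = contradiction (trans (sym c-true) (trans (evalClause-cong b (flipAt i a) c b≡flip) c-flip)) λ ()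
    where
    c = first (shortCritical a i) [] D
    critical = witness-critical D a i Da (∧-true-l Db)
    c-true : evalClause b c ≡ true
    c-true = proj₂ critical
    c-flip : evalClause (flipAt i a) c ≡ false
    c-flip = not-injective (∧-true-l (proj₁ critical))
    b≡flip : ∀ l → mentions c l ≡ true → b l ≡ flipAt i a l
    b≡flip l m with l ≡ᵇ i in l≡i
    ... | true  = let l≡i′ = ≡ᵇ⇒≡ l≡i in
      trans (cong b l≡i′) (trans (¬-not bi≢ai) (trans (sym (flipAt-same i a)) (cong (flipAt i a) (sym l≡i′))))
    ... | false = trans (agree l m l≡i) (sym (flipAt-other i l a (trans (≡ᵇ-sym i l) l≡i)))

  count-allShort : ∀ D → suc w * suc w ≤ n → count n (AllShort D) * 2 ^ suc w ≤ 2 ^ n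
  count-allShort D = Isolation.isolated-bound n (witness D) w (AllShort D) (allShort-isolated D)
    (λ a Da i → ≤ᵇ-true⇒≤ _ w (∧-true-r {not (evalClause (flipAt i a) (first (shortCritical a i) [] D))}
                                          (proj₁ (witness-critical D a i Da (∧-true-l Da)))))

  count-longCritical : ∀ c i → count n (longCritical c i) * 2 ^ suc w ≤ 2 ^ n
  count-longCritical c i = bound (width c i ≤ᵇ w) refl
    where
    fixed : ∀ x → longCritical c i x ≡ true → ∀ l → (mentions c l ∧ not (l ≡ᵇ i)) ≡ true → x l ≡ falsifier c l
    fixed x lc l ml = trans (sym (flipAt-other i l x (trans (≡ᵇ-sym i l) (not-injective (∧-true-r {mentions c l} ml)))))
      (falsified⇒falsifier (flipAt i x) c (not-injective (∧-true-l lc)) l (∧-true-l ml))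
    bound : ∀ b → (width c i ≤ᵇ w) ≡ b → count n (longCritical c i) * 2 ^ suc w ≤ 2 ^ n
    bound true  short rewrite count-none n (longCritical c i) (λ x lc →
      contradiction (trans (cong not (sym short)) (∧-true-r {not (evalClause (flipAt i x) c)} lc)) λ ()) = z≤n
    bound false long = ≤-trans (*-monoʳ-≤ (count n (longCritical c i)) (^-monoʳ-≤ 2 (≤ᵇ-false⇒> (width c i) w long)))
      (subcube-bound n (longCritical c i) (λ l → mentions c l ∧ not (l ≡ᵇ i)) (falsifier c) fixed)

  count-someLong : ∀ c → count n (SomeLong c) * 2 ^ suc w ≤ n * 2 ^ n
  count-someLong c = begin
    count n (SomeLong c) * 2 ^ suc w                      ≤⟨ *-monoˡ-≤ (2 ^ suc w) union-bound ⟩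
    sumFin (λ i → count n (longCritical c i)) * 2 ^ suc w ≡⟨ sumFin-*ʳ (λ i → count n (longCritical c i)) (2 ^ suc w) ⟩
    sumFin (λ i → count n (longCritical c i) * 2 ^ suc w) ≤⟨ sumFin-mono (count-longCritical c) ⟩
    sumFin {n} (λ _ → 2 ^ n)                              ≡⟨ sumFin-const n (2 ^ n) ⟩
    n * 2 ^ n                                             ∎
    where
    open ≤-Reasoning
    union-bound : count n (SomeLong c) ≤ sumFin (λ i → count n (longCritical c i))
    union-bound = ≤-trans (sumCube-mono n (λ x → χ-anyᶠ≤sumFin (λ i → longCritical c i x)))
                          (≤-reflexive (sumCube-sumFin n (λ i x → χ (longCritical c i x))))

  module _ (Ds : List (List (Clause n))) (Cs : List (Clause n)) (sub : ∀ {D c} → D ∈ Ds → c ∈ D → c ∈ Cs)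
           (computes : ∀ x → any (all (evalClause x)) Ds ≡ parity n x) where

    parity-covered : ∀ x → parity n x ≡ true →
      (∃[ D ] D ∈ Ds × AllShort D x ≡ true) ⊎ (∃[ c ] c ∈ Cs × SomeLong c x ≡ true)
    parity-covered x odd with any⇒∃ _ Ds (trans (computes x) odd)
    ... | D , D∈Ds , Dx with allᶠ (λ i → any (shortCritical x i) D) in allShort
    ... | true  = inj₁ (D , D∈Ds , cong₂ _∧_ Dx allShort)
    ... | false with allᶠ≡false⇒∃ _ allShort
    ... | i , noShort with all≡false⇒∃ (evalClause (flipAt i x)) D (any≡false⇒ (all (evalClause (flipAt i x)))
                             (trans (computes (flipAt i x)) (trans (parity-flipAt n i x) (cong not odd))) D∈Ds)
    ... | c , c∈D , c-flip =
      inj₂ (c , sub D∈Ds c∈D , ⇒anyᶠ (λ i → longCritical c i x) i (cong₂ _∧_ (cong not c-flip) (cong not long)))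
      where
      long : (width c i ≤ᵇ w) ≡ false
      long = trans (cong (λ e → not e ∧ (width c i ≤ᵇ w)) (sym c-flip)) (any≡false⇒ (shortCritical x i) noShort c∈D)

    χ-parity≤ : ∀ x → χ (parity n x) ≤ sum (map (λ D → χ (AllShort D x)) Ds) + sum (map (λ c → χ (SomeLong c x)) Cs)
    χ-parity≤ x with parity n x in odd
    ... | false = z≤n
    ... | true with parity-covered x odd
    ... | inj₁ (D , D∈Ds , short) =
      ≤-trans (≤-reflexive (cong χ (sym (∈⇒any (λ D → AllShort D x) D∈Ds short)))) (≤-trans (χ-any≤sum _ Ds) (m≤m+n _ _))
    ... | inj₂ (c , c∈Cs , long) =
      ≤-trans (≤-reflexive (cong χ (sym (∈⇒any (λ c → SomeLong c x) c∈Cs long)))) (≤-trans (χ-any≤sum _ Cs) (m≤n+m _ _))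

    parity-count-bound : suc w * suc w ≤ n → count n (parity n) * 2 ^ suc w ≤ length Ds * 2 ^ n + length Cs * (n * 2 ^ n)
    parity-count-bound k²≤n = begin
      count n (parity n) * 2 ^ k
        ≤⟨ *-monoˡ-≤ (2 ^ k) (sumCube-mono n χ-parity≤) ⟩
      sumCube n (λ x → sum (map (λ D → χ (AllShort D x)) Ds) + sum (map (λ c → χ (SomeLong c x)) Cs)) * 2 ^ k
        ≡⟨ cong (_* 2 ^ k) (trans (sumCube-+ n _ _) (cong₂ _+_ (sumCube-sum n (λ D x → χ (AllShort D x)) Ds)
                                                               (sumCube-sum n (λ c x → χ (SomeLong c x)) Cs))) ⟩
      (sum (map (λ D → count n (AllShort D)) Ds) + sum (map (λ c → count n (SomeLong c)) Cs)) * 2 ^ k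
        ≡⟨ trans (*-distribʳ-+ (2 ^ k) (sum (map (λ D → count n (AllShort D)) Ds)) _)
                 (cong₂ _+_ (sum-map-*ʳ (λ D → count n (AllShort D)) (2 ^ k) Ds) (sum-map-*ʳ (λ c → count n (SomeLong c)) (2 ^ k) Cs)) ⟩
      sum (map (λ D → count n (AllShort D) * 2 ^ k) Ds) + sum (map (λ c → count n (SomeLong c) * 2 ^ k) Cs)
        ≤⟨ +-mono-≤ (sum-map-bound _ (2 ^ n) Ds (λ D → count-allShort D k²≤n)) (sum-map-bound _ (n * 2 ^ n) Cs count-someLong) ⟩
      length Ds * 2 ^ n + length Cs * (n * 2 ^ n) ∎
      where
      open ≤-Reasoning
      k = suc w

length-concat : ∀ {A : Set} (F : List (List A)) → length (concat F) ≡ sum (map length F)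
length-concat []           = refl
length-concat (D List.∷ F) = trans (length-++ D) (cong (length D +_) (length-concat F))

-- Of the 2 ^ n odd points of the (n + 1)-cube, each CNF covers at most 2 ^ (n + 1 - k) through
-- short critical clauses and each clause at most (n + 1) 2 ^ (n + 1 - k) through long ones.
cnf-family-bound : ∀ n (Ds : List (List (Clause (suc n)))) (Cs : List (Clause (suc n))) →
  (∀ {D c} → D ∈ Ds → c ∈ D → c ∈ Cs) → (∀ x → any (all (evalClause x)) Ds ≡ parity (suc n) x) →
  ∀ k → k * k ≤ suc n → 2 ^ k ≤ 2 * suc n * (length Ds + length Cs)
cnf-family-bound n Ds Cs sub computes zero _ = ≤-trans (s≤s z≤n) (cnf-family-bound n Ds Cs sub computes 1 (s≤s z≤n))
cnf-family-bound n Ds Cs sub computes (suc w) k²≤n = ≤-trans (*-cancelˡ-≤ (2 ^ n) {{m^n≢0 2 n}} scaled) fewer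
  where
  open Critical (suc n) w using (parity-count-bound)
  L = length Ds
  ∣Cs∣ = length Cs
  scaled : 2 ^ n * 2 ^ suc w ≤ 2 ^ n * (2 * (L + ∣Cs∣ * suc n))
  scaled = subst₂ _≤_ (cong (_* 2 ^ suc w) (count-parity n)) (regroup L ∣Cs∣ (suc n) (2 ^ n))
             (parity-count-bound Ds Cs sub computes k²≤n)
    where
    regroup : ∀ a b N q → a * (2 * q) + b * (N * (2 * q)) ≡ q * (2 * (a + b * N))
    regroup = solve-∀
  fewer : 2 * (L + ∣Cs∣ * suc n) ≤ 2 * suc n * (L + ∣Cs∣)
  fewer = ≤-trans (*-monoʳ-≤ 2 (+-mono-≤ (m≤n*m L (suc n)) (≤-reflexive (*-comm ∣Cs∣ (suc n)))))
            (≤-reflexive (regroup (suc n) L ∣Cs∣))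
    where
    regroup : ∀ N a b → 2 * (N * a + N * b) ≡ 2 * N * (a + b)
    regroup = solve-∀

formula-bound : ∀ n → 1 ≤ n → (F : Σ3Formula n) → ComputesF F (parity n) →
  ∀ k → k * k ≤ n → 2 ^ k ≤ 2 * n * formulaSize F
formula-bound (suc n) _ F computes k k²≤n =
  subst (λ s → 2 ^ k ≤ 2 * suc n * (length F + s)) (length-concat F)
    (cnf-family-bound n F (concat F) (λ D∈F c∈D → ∈-concat⁺′ c∈D D∈F) computes k k²≤n)

circuit-bound : ∀ n → 1 ≤ n → (C : Σ3Circuit n) → ComputesC C (parity n) →
  ∀ k → 2 * (k * k) ≤ n → 2 ^ k ≤ 2 * n * circuitSize C
circuit-bound (suc n) _ C computes k 2k²≤n =
  subst (λ s → 2 ^ k ≤ 2 * suc n * s) size≡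
    (cnf-family-bound n Ds Cs sub computes′ k (≤-trans (m≤m+n (k * k) (k * k + 0)) 2k²≤n))
  where
  cl = clauses C
  Ds = map (map cl) (ands C)
  Cs = tabulate cl
  size≡ : length Ds + length Cs ≡ circuitSize C
  size≡ = trans (cong₂ _+_ (length-map (map cl) (ands C)) (length-tabulate cl)) (+-comm (length (ands C)) (m C))
  sub : ∀ {D c} → D ∈ Ds → c ∈ D → c ∈ Cs
  sub D∈Ds c∈D with ∈-map⁻ (map cl) D∈Ds
  ... | A , _ , refl with ∈-map⁻ cl c∈D
  ... | j , _ , refl = ∈-tabulate⁺ j
  computes′ : ∀ x → any (all (evalClause x)) Ds ≡ parity (suc n) x
  computes′ x = trans (cong or (trans (sym (map-∘ (ands C))) (map-cong (λ A → cong and (sym (map-∘ A))) (ands C))))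
                      (computes x)

mainTheorem5 :
    (∃[ d ] ∃[ n₀ ] (0 < d) ×
      (∀ n → n₀ ≤ n → (F : Σ3Formula n) → ComputesF F (parity n) →
        ∀ k → k * k ≤ n → 2 ^ k ≤ d * n * formulaSize F))
    ×
    (∃[ d ] ∃[ n₀ ] (0 < d) ×
      (∀ n → n₀ ≤ n → (C : Σ3Circuit n) → ComputesC C (parity n) →
        ∀ k → 2 * (k * k) ≤ n → 2 ^ k ≤ d * n * circuitSize C))
mainTheorem5 = (2 , 1 , s≤s z≤n , formula-bound) , (2 , 1 , s≤s z≤n , circuit-bound)
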